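{- Let $r\ge4$, $s\ge3$, $0\le t\le s-1$, $G=T(r,s,t)$, and let $\mathcal L$ be a list assignment on $G$ with every list of size $5$, satisfying criteria (i)–(iv). Then: (1) If $H$ is an isolated component of a list-class $G[L]$ with $V(H)=\{(i,j)\}$, then there are distinct lists $L',L''$ of $\mathcal L$ such that $L(i-1,j+1)=L(i,j+1)=L(i+1,j+1)=L(i+1,j)=L'$ and $L(i-1,j)=L(i-1,j-1)=L(i,j-1)=L(i+1,j-1)=L''$. (2) If $H$ is a nonisolated component of a list-class $G[L]$ and $v\in V(H)$, then at least one vertical neighbor of $v$ also belongs to $V(H)$.
   Context: $T(r,s,t)$: vertex set $\{(i,j):1\le i\le r,1\le j\le s\}$. Index convention: for arbitrary integers $i,j$, the symbol $(i,j)$ denotes the vertex $(i',j')$ where $i=i'+mr$ with $1\le i'\le r$ and $j'\equiv j-mt\pmod s$. Every vertex $(i,j)$ is adjacent exactly to $(i,j\pm1)$ (vertical neighbors), $(i-1,j),(i-1,j+1)$ (left neighbors) and $(i+1,j),(i+1,j-1)$ (right neighbors); column $C_i=\{(i,j):1\le j\le s\}$. $\mathcal L$ gives each vertex a list; write $L(i,j)$ for the list of $(i,j)$. For a list $L$, the list-class $G[L]$ is the subgraph of $G$ induced on the vertices whose list equals $L$; a connected component of $G[L]$ is isolated if it has one vertex, nonisolated otherwise. Criteria: (i) not all lists are identical, and for every $(i,j)$, $L(i,j)\subseteq L(i-1,j)\cup L(i-1,j+1)$ and $L(i,j)\subseteq L(i+1,j)\cup L(i+1,j-1)$. (ii) Whenever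 $L(i,j)\neq L(i,j-1)$, one of the following holds: (a) $L(i,j)=L(i-1,j+1)$ and $L(i,j-1)=L(i-1,j-1)$; (b) $L(i,j)=L(i-1,j+1)=L(i-1,j)$ and $L(i,j-1)\neq L(i-1,j-1)$; (c) $L(i,j)\neq L(i-1,j+1)$ and $L(i,j-1)=L(i-1,j)=L(i-1,j-1)$; and also one of the following holds: (a') $L(i,j)=L(i+1,j)$ and $L(i,j-1)=L(i+1,j-2)$; (b') $L(i,j-1)=L(i+1,j-2)=L(i+1,j-1)$ and $L(i,j)\neq L(i+1,j)$; (c') $L(i,j-1)\neq L(i+1,j-2)$ and $L(i,j)=L(i+1,j-1)=L(i+1,j)$. (iii) Whenever $u,v$ are adjacent vertices in distinct columns with $L(u)=L(v)$, there is a vertex $w$ adjacent to both with $L(w)=L(u)$. (iv) Whenever $u,v,w$ are pairwise adjacent with identical lists and $v,w$ lie in the same column, at least one vertical neighbor of $u$ has list equal to $L(u)$. -}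

module Defs where

open import Data.Nat as ℕ using (ℕ; NonZero)
open import Data.Integer as ℤ using (ℤ; +_; -[1+_]; _+_; _-_; _*_)
open import Data.Integer.DivMod using (_%ℕ_; _/ℕ_; n%ℕd<d)
open import Data.Fin using (Fin; toℕ; fromℕ<)
open import Data.Product using (_×_; _,_; proj₁; proj₂; Σ; ∃)
open import Data.Sum using (_⊎_)
open import Data.List using (List; length)
open import Data.List.Membership.Propositional using (_∈_)
open import Data.List.Relation.Binary.Subset.Propositional using (_⊆_)
open import Data.List.Relation.Unary.Unique.Propositional using (Unique)
open import Relation.Binary.PropositionalEquality using (_≡_)
open import Relation.Nullary using (¬_)

-- Colours are natural numbers; a "list" (in the
-- list-colouring sense) is a set of colours, represented by a
-- duplicate-free List ℕ, and two lists are equal iff they have the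
-- same elements.
Colours : Set
Colours = List ℕ

_≈L_ : Colours → Colours → Set
A ≈L B = (A ⊆ B) × (B ⊆ A)

_⊆_∪_ : Colours → Colours → Colours → Set
A ⊆ B ∪ C = ∀ {x} → x ∈ A → (x ∈ B) ⊎ (x ∈ C)

-- The graph T(r,s,t).  Vertices are 0-indexed: (i,j) with 0 ≤ i < r,
-- 0 ≤ j < s (the paper's vertex (i+1,j+1)).
module Torus (r s t : ℕ) .{{_ : NonZero r}} .{{_ : NonZero s}} where

  Vertex : Set
  Vertex = Fin r × Fin s

  -- index convention: (i,j) ↦ (i', j') with i = i' + m r, 0 ≤ i' < r,
  -- j' ≡ j - m t (mod s)
  norm : ℤ → ℤ → Vertex
  norm i j = fromℕ< (n%ℕd<d i r)
           , fromℕ< (n%ℕd<d (j - (i /ℕ r) * + t) s)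

  at : Vertex → ℤ → ℤ → Vertex
  at (i , j) di dj = norm (+ toℕ i + di) (+ toℕ j + dj)

  -1ℤ : ℤ
  -1ℤ = -[1+ 0 ]

  Vert : Vertex → Vertex → Set
  Vert v w = (w ≡ at v (+ 0) (+ 1)) ⊎ (w ≡ at v (+ 0) -1ℤ)

  Adj : Vertex → Vertex → Set
  Adj v w = Vert v w
          ⊎ (w ≡ at v -1ℤ (+ 0)) ⊎ (w ≡ at v -1ℤ (+ 1))
          ⊎ (w ≡ at v (+ 1) (+ 0)) ⊎ (w ≡ at v (+ 1) -1ℤ)

  column : Vertex → Fin r
  column = proj₁

  ListAssignment : Set
  ListAssignment = Vertex → Colours

  Size5 : ListAssignment → Set
  Size5 L = ∀ v → Unique (L v) × length (L v) ≡ 5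

  module _ (L : ListAssignment) where

    Lat : Vertex → ℤ → ℤ → Colours
    Lat v di dj = L (at v di dj)

    Crit-i : Set
    Crit-i = (Σ Vertex λ u → Σ Vertex λ v → ¬ (L u ≈L L v))
           × (∀ v → L v ⊆ Lat v -1ℤ (+ 0) ∪ Lat v -1ℤ (+ 1))
           × (∀ v → L v ⊆ Lat v (+ 1) (+ 0) ∪ Lat v (+ 1) -1ℤ)

    Crit-ii : Set
    Crit-ii = ∀ v → ¬ (L v ≈L Lat v (+ 0) -1ℤ) →
      let Lij   = L v
          Lij-1 = Lat v (+ 0) -1ℤ
      in ( ((Lij ≈L Lat v -1ℤ (+ 1)) × (Lij-1 ≈L Lat v -1ℤ -1ℤ))
         ⊎ ((Lij ≈L Lat v -1ℤ (+ 1)) × (Lat v -1ℤ (+ 1) ≈L Lat v -1ℤ (+ 0))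
             × ¬ (Lij-1 ≈L Lat v -1ℤ -1ℤ))
         ⊎ (¬ (Lij ≈L Lat v -1ℤ (+ 1)) × (Lij-1 ≈L Lat v -1ℤ (+ 0))
             × (Lat v -1ℤ (+ 0) ≈L Lat v -1ℤ -1ℤ)) )
       × ( ((Lij ≈L Lat v (+ 1) (+ 0)) × (Lij-1 ≈L Lat v (+ 1) (ℤ.-[1+ 1 ])))
         ⊎ ((Lij-1 ≈L Lat v (+ 1) (ℤ.-[1+ 1 ])) × (Lat v (+ 1) (ℤ.-[1+ 1 ]) ≈L Lat v (+ 1) -1ℤ)
             × ¬ (Lij ≈L Lat v (+ 1) (+ 0)))
         ⊎ (¬ (Lij-1 ≈L Lat v (+ 1) (ℤ.-[1+ 1 ])) × (Lij ≈L Lat v (+ 1) -1ℤ)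
             × (Lat v (+ 1) -1ℤ ≈L Lat v (+ 1) (+ 0))) )

    Crit-iii : Set
    Crit-iii = ∀ u v → Adj u v → ¬ (column u ≡ column v) → L u ≈L L v →
      Σ Vertex λ w → Adj w u × Adj w v × (L w ≈L L u)

    Crit-iv : Set
    Crit-iv = ∀ u v w → Adj u v → Adj u w → Adj v w →
      L u ≈L L v → L u ≈L L w → column v ≡ column w →
      Σ Vertex λ x → Vert u x × (L x ≈L L u)

    -- paths in the list-class G[A] (subgraph induced on vertices whose
    -- list equals A): Path A u w iff w lies in the component of G[A]
    -- containing u (for u in G[A]).
    data Path (A : Colours) (u : Vertex) : Vertex → Set where
      here : L u ≈L A → Path A u u
      step : ∀ {v w} → Path A u v → Adj v w → L w ≈L A → Path A u w

    InComp : Vertex → Vertex → Set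
    InComp v w = Path (L v) v w

    Isolated : Vertex → Set
    Isolated v = ∀ w → InComp v w → w ≡ v

-- (1) If {(i,j)} is a component of its list-class, no neighbour shares its list.  This rules
-- out all alternatives of criterion (ii) except (c),(b′) at (i,j) and (b),(c′) at (i,j+1),
-- which give the stated pattern with L′ = L(i,j+1) and L″ = L(i,j-1).  If L′ = L″, then by
-- criterion (i) L(i,j) ⊆ L(i-1,j) ∪ L(i-1,j+1) = L″, and two 5-sets with L(i,j) ⊆ L(i,j-1)
-- coincide, contradicting isolation.
-- (2) A vertex v with a neighbour u of the same list, not vertically above or below it, has
-- by criterion (iii) a common neighbour w of v and u with that list.  The triangle v u w
-- cannot consist of slanted edges only: each changes the column by ±1, and ±1 ± 1 ± 1 is not
-- 0 modulo r ≥ 4.  A vertical edge at v is what we want, and a vertical edge u w lets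
-- criterion (iv) produce a vertical neighbour of v with the same list.

module Submission where

open import Defs
open import Data.Nat as ℕ using (ℕ; NonZero; zero; suc; _≤_; _<_; z≤n; s≤s)
import Data.Nat.Properties as ℕP
open import Data.Integer as ℤ using (ℤ; +_; -[1+_]; _+_; _-_; _*_; -_; ∣_∣)
import Data.Integer.Properties as ℤP
open import Data.Integer.DivMod using (_%ℕ_; _/ℕ_; n%ℕd<d; a≡a%ℕn+[a/ℕn]*n)
open import Data.Integer.Solver using (module +-*-Solver)
open import Data.Fin using (toℕ; fromℕ<)
open import Data.Fin.Properties using (toℕ<n; fromℕ<-cong; fromℕ<-toℕ; toℕ-fromℕ<)
open import Data.List using (List; _∷_; length)
open import Data.List.Membership.Propositional using (_∈_)
import Data.List.Membership.DecPropositional as DecMembership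
open import Data.List.Relation.Unary.Any using (here; there)
import Data.List.Relation.Unary.All as All
open import Data.List.Relation.Unary.AllPairs using ([]; _∷_)
open import Data.List.Relation.Unary.Unique.Propositional using (Unique)
open import Data.List.Relation.Binary.Subset.Propositional using (_⊆_)
open import Data.List.Relation.Binary.Subset.Propositional.Properties using (⊆-refl; ⊆-trans)
open import Data.Product using (_×_; _,_; proj₁; proj₂; Σ; ∃)
open import Data.Sum using (_⊎_; inj₁; inj₂)
open import Function using (_∘_; case_of_)
open import Relation.Binary.Definitions using (DecidableEquality)
open import Relation.Binary.PropositionalEquality
  using (_≡_; _≢_; refl; sym; trans; cong; cong₂; subst; module ≡-Reasoning)
open import Relation.Nullary using (¬_; yes; no; contradiction)
open +-*-Solver using (solve; _:=_; _:+_; _:-_; _:*_)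
open ≡-Reasoning

-- Euclidean division on ℤ

m*n<n⇒m≡0 : ∀ m n → m ℕ.* n < n → m ≡ 0
m*n<n⇒m≡0 zero    n _  = refl
m*n<n⇒m≡0 (suc m) n lt = contradiction lt (ℕP.≤⇒≯ (ℕP.m≤m+n n (m ℕ.* n)))

∣m-n∣<o : ∀ {m n o} → m < o → n < o → ∣ + m - + n ∣ < o
∣m-n∣<o {m} {n} m<o n<o rewrite ℤP.m-n≡m⊖n m n with ℕP.≤-total m n
... | inj₁ m≤n rewrite ℤP.∣⊖∣-≤ m≤n = ℕP.≤-<-trans (ℕP.m∸n≤m n m) n<o
... | inj₂ n≤m rewrite ℤP.∣m⊖n∣≡∣n⊖m∣ m n | ℤP.∣⊖∣-≤ n≤m = ℕP.≤-<-trans (ℕP.m∸n≤m m n) m<o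

module _ (n : ℕ) .{{_ : NonZero n}} where

  multiple-<⇒0 : ∀ q → ∣ q * + n ∣ < n → q ≡ + 0
  multiple-<⇒0 q lt =
    ℤP.∣i∣≡0⇒i≡0 (m*n<n⇒m≡0 ∣ q ∣ n (subst (_< n) (ℤP.abs-* q (+ n)) lt))

  divMod-unique : ∀ {m m′} q q′ → m < n → m′ < n →
    + m + q * + n ≡ + m′ + q′ * + n → m ≡ m′ × q ≡ q′
  divMod-unique {m} {m′} q q′ m<n m′<n eq = ℤP.+-injective m≡m′ , q≡q′
    where
    difference : + m - + m′ ≡ (q′ - q) * + n
    difference = begin
      + m - + m′                                 ≡⟨ shift (+ m) (+ m′) q (+ n) ⟩
      (+ m + q * + n) - (+ m′ + q * + n)         ≡⟨ cong (_- (+ m′ + q * + n)) eq ⟩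
      (+ m′ + q′ * + n) - (+ m′ + q * + n)       ≡⟨ collect (+ m′) q q′ (+ n) ⟩
      (q′ - q) * + n                             ∎
      where
      shift : ∀ a b c N → a - b ≡ (a + c * N) - (b + c * N)
      shift = solve 4 (λ a b c N → a :- b := (a :+ c :* N) :- (b :+ c :* N)) refl
      collect : ∀ b c d N → (b + d * N) - (b + c * N) ≡ (d - c) * N
      collect = solve 4 (λ b c d N → (b :+ d :* N) :- (b :+ c :* N) := (d :- c) :* N) refl
    q′-q≡0 : q′ - q ≡ + 0
    q′-q≡0 = multiple-<⇒0 (q′ - q) (subst (λ x → ∣ x ∣ < n) difference (∣m-n∣<o m<n m′<n))
    q≡q′ : q ≡ q′
    q≡q′ = sym (ℤP.i-j≡0⇒i≡j q′ q q′-q≡0)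
    m≡m′ : + m ≡ + m′
    m≡m′ = ℤP.i-j≡0⇒i≡j (+ m) (+ m′)
      (trans difference (trans (cong (_* + n) q′-q≡0) (ℤP.*-zeroˡ (+ n))))

  +-multiple-%ℕ-/ℕ : ∀ y k → (y + k * + n) %ℕ n ≡ y %ℕ n × (y + k * + n) /ℕ n ≡ y /ℕ n + k
  +-multiple-%ℕ-/ℕ y k =
    divMod-unique ((y + k * + n) /ℕ n) (y /ℕ n + k) (n%ℕd<d (y + k * + n) n) (n%ℕd<d y n) (begin
      + ((y + k * + n) %ℕ n) + ((y + k * + n) /ℕ n) * + n  ≡⟨ a≡a%ℕn+[a/ℕn]*n (y + k * + n) n ⟨
      y + k * + n                                          ≡⟨ cong (_+ k * + n) (a≡a%ℕn+[a/ℕn]*n y n) ⟩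
      (+ (y %ℕ n) + (y /ℕ n) * + n) + k * + n              ≡⟨ regroup (+ (y %ℕ n)) (y /ℕ n) k (+ n) ⟩
      + (y %ℕ n) + (y /ℕ n + k) * + n                      ∎)
    where
    regroup : ∀ a b c N → (a + b * N) + c * N ≡ a + (b + c) * N
    regroup = solve 4 (λ a b c N → (a :+ b :* N) :+ c :* N := a :+ (b :+ c) :* N) refl

  small-%ℕ-/ℕ : ∀ {m} → m < n → (+ m) %ℕ n ≡ m × (+ m) /ℕ n ≡ + 0
  small-%ℕ-/ℕ {m} m<n = divMod-unique _ (+ 0) (n%ℕd<d (+ m) n) m<n (begin
    + ((+ m) %ℕ n) + ((+ m) /ℕ n) * + n  ≡⟨ a≡a%ℕn+[a/ℕn]*n (+ m) n ⟨
    + m                                  ≡⟨ ℤP.+-identityʳ (+ m) ⟨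
    + m + + 0                            ∎)

  +-%ℕ-fixed⇒0 : ∀ {m} p → ∣ p ∣ < n → (+ m + p) %ℕ n ≡ m → p ≡ + 0
  +-%ℕ-fixed⇒0 {m} p ∣p∣<n fixed = begin
    p          ≡⟨ p≡q*n ⟩
    q * + n    ≡⟨ cong (_* + n) q≡0 ⟩
    + 0 * + n  ≡⟨ ℤP.*-zeroˡ (+ n) ⟩
    + 0        ∎
    where
    q = (+ m + p) /ℕ n
    p≡q*n : p ≡ q * + n
    p≡q*n = begin
      p                                     ≡⟨ cancel (+ m) p ⟩
      (+ m + p) - + m                       ≡⟨ cong (_- + m) (a≡a%ℕn+[a/ℕn]*n (+ m + p) n) ⟩
      (+ ((+ m + p) %ℕ n) + q * + n) - + m  ≡⟨ cong (λ x → (+ x + q * + n) - + m) fixed ⟩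
      (+ m + q * + n) - + m                 ≡⟨ cancel (+ m) (q * + n) ⟨
      q * + n                               ∎
      where
      cancel : ∀ a b → b ≡ (a + b) - a
      cancel = solve 2 (λ a b → b := (a :+ b) :- a) refl
    q≡0 : q ≡ + 0
    q≡0 = multiple-<⇒0 q (subst (λ x → ∣ x ∣ < n) p≡q*n ∣p∣<n)

≈L-refl : ∀ {A} → A ≈L A
≈L-refl = ⊆-refl , ⊆-refl

≈L-sym : ∀ {A B} → A ≈L B → B ≈L A
≈L-sym (A⊆B , B⊆A) = B⊆A , A⊆B

≈L-trans : ∀ {A B C} → A ≈L B → B ≈L C → A ≈L C
≈L-trans (A⊆B , B⊆A) (B⊆C , C⊆B) = ⊆-trans A⊆B B⊆C , ⊆-trans C⊆B B⊆A

≡⇒≈L : ∀ {A B} → A ≡ B → A ≈L B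
≡⇒≈L refl = ≈L-refl

module _ {a} {X : Set a} where

  ∈-remove : ∀ {y : X} {ys} → y ∈ ys →
    ∃ λ ys′ → length ys ≡ suc (length ys′) × (∀ {z} → z ∈ ys → z ≢ y → z ∈ ys′)
  ∈-remove {ys = _ ∷ ys} (here refl) = ys , refl , keep
    where
    keep : ∀ {z} → z ∈ _ ∷ ys → z ≢ _ → z ∈ ys
    keep (here refl) z≢y = contradiction refl z≢y
    keep (there z∈ys) _  = z∈ys
  ∈-remove {ys = x ∷ ys} (there y∈ys) with ∈-remove y∈ys
  ... | ys′ , len , keep = x ∷ ys′ , cong suc len , keep′
    where
    keep′ : ∀ {z} → z ∈ x ∷ ys → z ≢ _ → z ∈ x ∷ ys′
    keep′ (here refl)  _    = here refl
    keep′ (there z∈ys) z≢y = there (keep z∈ys z≢y)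

  Unique-⊆⇒length-≤ : ∀ {xs ys : List X} → Unique xs → xs ⊆ ys → length xs ≤ length ys
  Unique-⊆⇒length-≤ [] _ = z≤n
  Unique-⊆⇒length-≤ {x ∷ xs} (x∉xs ∷ xs!) xs⊆ys with ∈-remove (xs⊆ys (here refl))
  ... | ys′ , len , keep = subst (suc (length xs) ≤_) (sym len)
    (s≤s (Unique-⊆⇒length-≤ xs! λ z∈xs →
      keep (xs⊆ys (there z∈xs)) (λ z≡x → All.lookup x∉xs z∈xs (sym z≡x))))

  module _ (_≟_ : DecidableEquality X) where
    open DecMembership _≟_ using (_∈?_)

    Unique-⊆-length-≡⇒⊇ : ∀ {xs ys : List X} → Unique xs → length xs ≡ length ys →
      xs ⊆ ys → ys ⊆ xs
    Unique-⊆-length-≡⇒⊇ {xs} xs! len xs⊆ys {y} y∈ys with y ∈? xs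
    ... | yes y∈xs = y∈xs
    ... | no  y∉xs with ∈-remove y∈ys
    ...   | ys′ , len′ , keep = contradiction too-long (ℕP.<-irrefl refl)
      where
      too-long : suc (length ys′) ≤ length ys′
      too-long = subst (_≤ length ys′) (trans len len′)
        (Unique-⊆⇒length-≤ xs! λ {z} z∈xs →
          keep (xs⊆ys z∈xs) (λ z≡y → y∉xs (subst (_∈ xs) z≡y z∈xs)))

-- The six neighbours of a vertex

data Direction : Set where
  up down left left-up right right-down : Direction

dx dy : Direction → ℤ
dx up         = + 0
dx down       = + 0
dx left       = -[1+ 0 ]
dx left-up    = -[1+ 0 ]
dx right      = + 1
dx right-down = + 1
dy up         = + 1
dy down       = -[1+ 0 ]
dy left       = + 0
dy left-up    = + 1
dy right      = + 0
dy right-down = -[1+ 0 ]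

opposite : Direction → Direction
opposite up         = down
opposite down       = up
opposite left       = right
opposite left-up    = right-down
opposite right      = left
opposite right-down = left-up

dx-opposite : ∀ d → dx (opposite d) ≡ - dx d
dx-opposite up         = refl
dx-opposite down       = refl
dx-opposite left       = refl
dx-opposite left-up    = refl
dx-opposite right      = refl
dx-opposite right-down = refl

dy-opposite : ∀ d → dy (opposite d) ≡ - dy d
dy-opposite up         = refl
dy-opposite down       = refl
dy-opposite left       = refl
dy-opposite left-up    = refl
dy-opposite right      = refl
dy-opposite right-down = refl

data Vertical : Direction → Set where
  up   : Vertical up
  down : Vertical down

data IsUnit : ℤ → Set where
  plus-one  : IsUnit (+ 1)
  minus-one : IsUnit -[1+ 0 ]

vertical-or-slanted : ∀ d → Vertical d ⊎ IsUnit (dx d)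
vertical-or-slanted up         = inj₁ up
vertical-or-slanted down       = inj₁ down
vertical-or-slanted left       = inj₂ minus-one
vertical-or-slanted left-up    = inj₂ minus-one
vertical-or-slanted right      = inj₂ plus-one
vertical-or-slanted right-down = inj₂ plus-one

IsUnit⇒≢0 : ∀ {a} → IsUnit a → a ≢ + 0
IsUnit⇒≢0 plus-one  ()
IsUnit⇒≢0 minus-one ()

∣IsUnit∣≡1 : ∀ {a} → IsUnit a → ∣ a ∣ ≡ 1
∣IsUnit∣≡1 plus-one  = refl
∣IsUnit∣≡1 minus-one = refl

Vertical-opposite : ∀ {d} → Vertical d → Vertical (opposite d)
Vertical-opposite up   = down
Vertical-opposite down = up

∣unit+unit+unit∣ : ∀ {a b c} → IsUnit a → IsUnit b → IsUnit c →
  ∣ a + b + c ∣ ≡ 1 ⊎ ∣ a + b + c ∣ ≡ 3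
∣unit+unit+unit∣ plus-one  plus-one  plus-one  = inj₂ refl
∣unit+unit+unit∣ plus-one  plus-one  minus-one = inj₁ refl
∣unit+unit+unit∣ plus-one  minus-one plus-one  = inj₁ refl
∣unit+unit+unit∣ plus-one  minus-one minus-one = inj₁ refl
∣unit+unit+unit∣ minus-one plus-one  plus-one  = inj₁ refl
∣unit+unit+unit∣ minus-one plus-one  minus-one = inj₁ refl
∣unit+unit+unit∣ minus-one minus-one plus-one  = inj₁ refl
∣unit+unit+unit∣ minus-one minus-one minus-one = inj₂ refl

-- Geometry of T(r,s,t)

module TorusGeometry (r s t : ℕ) .{{_ : NonZero r}} .{{_ : NonZero s}} where
  open Torus r s t

  norm-cong : ∀ {i j i′ j′} → i %ℕ r ≡ i′ %ℕ r →
    (j - (i /ℕ r) * + t) %ℕ s ≡ (j′ - (i′ /ℕ r) * + t) %ℕ s → norm i j ≡ norm i′ j′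
  norm-cong i≡i′ j≡j′ = cong₂ _,_ (fromℕ<-cong _ _ i≡i′ _ _) (fromℕ<-cong _ _ j≡j′ _ _)

  norm-periodic : ∀ {i j i′ j′} k m → i′ ≡ i + k * + r → j′ ≡ (j + k * + t) + m * + s →
    norm i′ j′ ≡ norm i j
  norm-periodic {i} {j} k m refl refl =
    norm-cong {i + k * + r} {(j + k * + t) + m * + s} {i} {j} (proj₁ (+-multiple-%ℕ-/ℕ r i k)) (begin
    ((j + k * + t) + m * + s - ((i + k * + r) /ℕ r) * + t) %ℕ s
      ≡⟨ cong (λ q → ((j + k * + t) + m * + s - q * + t) %ℕ s) (proj₂ (+-multiple-%ℕ-/ℕ r i k)) ⟩
    ((j + k * + t) + m * + s - (i /ℕ r + k) * + t) %ℕ s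
      ≡⟨ cong (_%ℕ s) (regroup j k m (i /ℕ r) (+ t) (+ s)) ⟩
    ((j - (i /ℕ r) * + t) + m * + s) %ℕ s
      ≡⟨ proj₁ (+-multiple-%ℕ-/ℕ s (j - (i /ℕ r) * + t) m) ⟩
    (j - (i /ℕ r) * + t) %ℕ s ∎)
    where
    regroup : ∀ j k m q T S → (j + k * T) + m * S - (q + k) * T ≡ (j - q * T) + m * S
    regroup = solve 6 (λ j k m q T S →
      (j :+ k :* T) :+ m :* S :- (q :+ k) :* T := (j :- q :* T) :+ m :* S) refl

  at-at : ∀ v a b c d → at (at v a b) c d ≡ at v (a + c) (b + d)
  at-at (i , j) a b c d = sym (norm-periodic {i = + toℕ (fromℕ< (n%ℕd<d I r)) + c}
                             {j = + toℕ (fromℕ< (n%ℕd<d Y s)) + d} q q′ column-eq row-eq)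
    where
    I = + toℕ i + a
    q = I /ℕ r
    Y = (+ toℕ j + b) - q * + t
    q′ = Y /ℕ s
    column-eq : + toℕ i + (a + c) ≡ (+ toℕ (fromℕ< (n%ℕd<d I r)) + c) + q * + r
    column-eq = begin
      + toℕ i + (a + c)                       ≡⟨ ℤP.+-assoc (+ toℕ i) a c ⟨
      I + c                                   ≡⟨ cong (_+ c) (a≡a%ℕn+[a/ℕn]*n I r) ⟩
      (+ (I %ℕ r) + q * + r) + c              ≡⟨ swap (+ (I %ℕ r)) (q * + r) c ⟩
      (+ (I %ℕ r) + c) + q * + r              ≡⟨ cong (λ x → (+ x + c) + q * + r) (toℕ-fromℕ< (n%ℕd<d I r)) ⟨
      (+ toℕ (fromℕ< (n%ℕd<d I r)) + c) + q * + r ∎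
      where
      swap : ∀ x y z → (x + y) + z ≡ (x + z) + y
      swap = solve 3 (λ x y z → (x :+ y) :+ z := (x :+ z) :+ y) refl
    row-eq : + toℕ j + (b + d) ≡ ((+ toℕ (fromℕ< (n%ℕd<d Y s)) + d) + q * + t) + q′ * + s
    row-eq = begin
      + toℕ j + (b + d)                       ≡⟨ unshift (+ toℕ j) b d (q * + t) ⟩
      (Y + d) + q * + t                       ≡⟨ cong (λ x → (x + d) + q * + t) (a≡a%ℕn+[a/ℕn]*n Y s) ⟩
      ((+ (Y %ℕ s) + q′ * + s) + d) + q * + t ≡⟨ swap (+ (Y %ℕ s)) (q′ * + s) d (q * + t) ⟩
      ((+ (Y %ℕ s) + d) + q * + t) + q′ * + s ≡⟨ cong (λ x → ((+ x + d) + q * + t) + q′ * + s) (toℕ-fromℕ< (n%ℕd<d Y s)) ⟨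
      ((+ toℕ (fromℕ< (n%ℕd<d Y s)) + d) + q * + t) + q′ * + s ∎
      where
      unshift : ∀ x y z w → x + (y + z) ≡ (((x + y) - w) + z) + w
      unshift = solve 4 (λ x y z w → x :+ (y :+ z) := (((x :+ y) :- w) :+ z) :+ w) refl
      swap : ∀ x y z w → ((x + y) + z) + w ≡ ((x + z) + w) + y
      swap = solve 4 (λ x y z w → ((x :+ y) :+ z) :+ w := ((x :+ z) :+ w) :+ y) refl

  at-vertical : ∀ v b → at v (+ 0) b ≡ (column v , fromℕ< (n%ℕd<d (+ toℕ (proj₂ v) + b) s))
  at-vertical (i , j) b = cong₂ _,_
    (trans (fromℕ<-cong _ _ (proj₁ i-small) _ (toℕ<n i)) (fromℕ<-toℕ i (toℕ<n i)))
    (fromℕ<-cong _ _ (trans (cong (λ q → ((+ toℕ j + b) - q * + t) %ℕ s) (proj₂ i-small))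
                            (cong (_%ℕ s) (ℤP.+-identityʳ (+ toℕ j + b)))) _ _)
    where
    i-small : (+ toℕ i + + 0) %ℕ r ≡ toℕ i × (+ toℕ i + + 0) /ℕ r ≡ + 0
    i-small = subst (λ x → x %ℕ r ≡ toℕ i × x /ℕ r ≡ + 0) (sym (ℤP.+-identityʳ (+ toℕ i)))
                (small-%ℕ-/ℕ r (toℕ<n i))

  column-at-vertical : ∀ v b → column (at v (+ 0) b) ≡ column v
  column-at-vertical v b = cong proj₁ (at-vertical v b)

  at-0-0 : ∀ v → at v (+ 0) (+ 0) ≡ v
  at-0-0 (i , j) = trans (at-vertical (i , j) (+ 0)) (cong (i ,_)
    (trans (fromℕ<-cong _ _ j-small _ (toℕ<n j)) (fromℕ<-toℕ j (toℕ<n j))))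
    where
    j-small : (+ toℕ j + + 0) %ℕ s ≡ toℕ j
    j-small = trans (cong (_%ℕ s) (ℤP.+-identityʳ (+ toℕ j))) (proj₁ (small-%ℕ-/ℕ s (toℕ<n j)))

  at-inverse : ∀ v a b → at (at v a b) (- a) (- b) ≡ v
  at-inverse v a b = begin
    at (at v a b) (- a) (- b)  ≡⟨ at-at v a b (- a) (- b) ⟩
    at v (a - a) (b - b)       ≡⟨ cong₂ (at v) (ℤP.+-inverseʳ a) (ℤP.+-inverseʳ b) ⟩
    at v (+ 0) (+ 0)           ≡⟨ at-0-0 v ⟩
    v                          ∎

  column-at-≡⇒0 : ∀ v a b → ∣ a ∣ < r → column (at v a b) ≡ column v → a ≡ + 0
  column-at-≡⇒0 (i , j) a b ∣a∣<r same =
    +-%ℕ-fixed⇒0 r a ∣a∣<r (trans (sym (toℕ-fromℕ< (n%ℕd<d (+ toℕ i + a) r))) (cong toℕ same))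

  at-vertical-≡⇒0 : ∀ v b → ∣ b ∣ < s → at v (+ 0) b ≡ v → b ≡ + 0
  at-vertical-≡⇒0 (i , j) b ∣b∣<s same =
    +-%ℕ-fixed⇒0 s b ∣b∣<s (trans (sym (toℕ-fromℕ< (n%ℕd<d (+ toℕ j + b) s)))
      (cong (toℕ ∘ proj₂) (trans (sym (at-vertical (i , j) b)) same)))

  move : Vertex → Direction → Vertex
  move v d = at v (dx d) (dy d)

  Adj⇒move : ∀ {v w} → Adj v w → Σ Direction λ d → w ≡ move v d
  Adj⇒move (inj₁ (inj₁ w≡))                   = up , w≡
  Adj⇒move (inj₁ (inj₂ w≡))                   = down , w≡
  Adj⇒move (inj₂ (inj₁ w≡))                   = left , w≡
  Adj⇒move (inj₂ (inj₂ (inj₁ w≡)))            = left-up , w≡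
  Adj⇒move (inj₂ (inj₂ (inj₂ (inj₁ w≡))))     = right , w≡
  Adj⇒move (inj₂ (inj₂ (inj₂ (inj₂ w≡))))     = right-down , w≡

  move⇒Adj : ∀ {v w} d → w ≡ move v d → Adj v w
  move⇒Adj up         w≡ = inj₁ (inj₁ w≡)
  move⇒Adj down       w≡ = inj₁ (inj₂ w≡)
  move⇒Adj left       w≡ = inj₂ (inj₁ w≡)
  move⇒Adj left-up    w≡ = inj₂ (inj₂ (inj₁ w≡))
  move⇒Adj right      w≡ = inj₂ (inj₂ (inj₂ (inj₁ w≡)))
  move⇒Adj right-down w≡ = inj₂ (inj₂ (inj₂ (inj₂ w≡)))

  move⇒Vert : ∀ {v w d} → Vertical d → w ≡ move v d → Vert v w
  move⇒Vert up   w≡ = inj₁ w≡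
  move⇒Vert down w≡ = inj₂ w≡

  column-move-vertical : ∀ v {d} → Vertical d → column (move v d) ≡ column v
  column-move-vertical v up   = column-at-vertical v (+ 1)
  column-move-vertical v down = column-at-vertical v -[1+ 0 ]

  move-opposite : ∀ v d → move (move v d) (opposite d) ≡ v
  move-opposite v d = begin
    at (at v (dx d) (dy d)) (dx (opposite d)) (dy (opposite d))
      ≡⟨ cong₂ (at (at v (dx d) (dy d))) (dx-opposite d) (dy-opposite d) ⟩
    at (at v (dx d) (dy d)) (- dx d) (- dy d)
      ≡⟨ at-inverse v (dx d) (dy d) ⟩
    v ∎

  move-back : ∀ {v w} d → w ≡ move v d → v ≡ move w (opposite d)
  move-back {v} d refl = sym (move-opposite v d)

  Adj-sym : ∀ {v w} → Adj v w → Adj w v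
  Adj-sym v~w with Adj⇒move v~w
  ... | d , w≡ = move⇒Adj (opposite d) (move-back d w≡)

  column-move-slanted : 1 < r → ∀ v {d} → IsUnit (dx d) → column (move v d) ≢ column v
  column-move-slanted 1<r v {d} unit same =
    IsUnit⇒≢0 unit (column-at-≡⇒0 v (dx d) (dy d) (subst (_< r) (sym (∣IsUnit∣≡1 unit)) 1<r) same)

  move-≢ : 1 < r → 1 < s → ∀ v d → move v d ≢ v
  move-≢ 1<r 1<s v d same with vertical-or-slanted d
  ... | inj₁ up   = contradiction (at-vertical-≡⇒0 v (+ 1) 1<s same) λ ()
  ... | inj₁ down = contradiction (at-vertical-≡⇒0 v -[1+ 0 ] 1<s same) λ ()
  ... | inj₂ unit = column-move-slanted 1<r v unit (cong column same)

  no-slanted-triangle : 4 ≤ r → ∀ v d₁ d₂ d₃ → IsUnit (dx d₁) → IsUnit (dx d₂) → IsUnit (dx d₃) →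
    move (move (move v d₁) d₂) d₃ ≢ v
  no-slanted-triangle 4≤r v d₁ d₂ d₃ u₁ u₂ u₃ closed
    with ∣unit+unit+unit∣ u₁ u₂ u₃
       | column-at-≡⇒0 v (dx d₁ + dx d₂ + dx d₃) (dy d₁ + dy d₂ + dy d₃) ∣sum∣<r
           (trans (cong column (sym three-steps)) (cong column closed))
    where
    three-steps : move (move (move v d₁) d₂) d₃ ≡ at v (dx d₁ + dx d₂ + dx d₃) (dy d₁ + dy d₂ + dy d₃)
    three-steps = trans (cong (λ w → at w (dx d₃) (dy d₃)) (at-at v (dx d₁) (dy d₁) (dx d₂) (dy d₂)))
                        (at-at v (dx d₁ + dx d₂) (dy d₁ + dy d₂) (dx d₃) (dy d₃))
    ∣sum∣<r : ∣ dx d₁ + dx d₂ + dx d₃ ∣ < r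
    ∣sum∣<r with ∣unit+unit+unit∣ u₁ u₂ u₃
    ... | inj₁ ≡1 = subst (_< r) (sym ≡1) (ℕP.≤-trans (s≤s (s≤s z≤n)) 4≤r)
    ... | inj₂ ≡3 = subst (_< r) (sym ≡3) 4≤r
  ... | inj₁ ≡1 | ≡0 = contradiction (trans (sym (cong ∣_∣ ≡0)) ≡1) λ ()
  ... | inj₂ ≡3 | ≡0 = contradiction (trans (sym (cong ∣_∣ ≡0)) ≡3) λ ()

-- List-classes

module ListClasses (r s t : ℕ) .{{_ : NonZero r}} .{{_ : NonZero s}}
                   (L : Torus.ListAssignment r s t) where
  open Torus r s t
  open TorusGeometry r s t

  Size5-⊆⇒≈L : Size5 L → ∀ {u w} → L u ⊆ L w → L u ≈L L w
  Size5-⊆⇒≈L size5 {u} {w} Lu⊆Lw = Lu⊆Lw , Unique-⊆-length-≡⇒⊇ ℕ._≟_ (proj₁ (size5 u))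
    (trans (proj₂ (size5 u)) (sym (proj₂ (size5 w)))) Lu⊆Lw

  Path⇒≡⊎first-move : ∀ {A u w} → Path L A u w → w ≡ u ⊎ Σ Vertex λ x → Adj u x × L x ≈L A
  Path⇒≡⊎first-move (here _) = inj₁ refl
  Path⇒≡⊎first-move (step p v~w Lw≈A) with Path⇒≡⊎first-move p
  ... | inj₁ refl  = inj₂ (_ , v~w , Lw≈A)
  ... | inj₂ first = inj₂ first

  same-list-neighbour⇒vertical : 4 ≤ r → Crit-iii L → Crit-iv L → ∀ {v u} → Adj v u → L u ≈L L v →
    Σ Vertex λ x → Vert v x × L x ≈L L v
  same-list-neighbour⇒vertical 4≤r crit-iii crit-iv {v} {u} v~u Lu≈Lv with Adj⇒move v~u
  ... | d₁ , u≡ with vertical-or-slanted d₁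
  ... | inj₁ vert₁ = u , move⇒Vert vert₁ u≡ , Lu≈Lv
  ... | inj₂ unit₁ with crit-iii v u v~u other-column (≈L-sym Lu≈Lv)
    where
    other-column : column v ≢ column u
    other-column same = column-move-slanted (ℕP.≤-trans (s≤s (s≤s z≤n)) 4≤r) v unit₁
                          (trans (cong column (sym u≡)) (sym same))
  ... | w , w~v , w~u , Lw≈Lv with Adj⇒move w~v | Adj⇒move (Adj-sym w~u)
  ... | d₂ , v≡ | d₃ , w≡ with vertical-or-slanted d₂ | vertical-or-slanted d₃
  ... | inj₁ vert₂ | _ = w , move⇒Vert (Vertical-opposite vert₂) (move-back d₂ v≡) , Lw≈Lv
  ... | inj₂ _ | inj₁ vert₃ =
    crit-iv v w u (Adj-sym w~v) v~u w~u (≈L-sym Lw≈Lv) (≈L-sym Lu≈Lv)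
      (trans (cong column w≡) (column-move-vertical u vert₃))
  ... | inj₂ unit₂ | inj₂ unit₃ =
    contradiction triangle (no-slanted-triangle 4≤r v d₁ d₃ d₂ unit₁ unit₃ unit₂)
    where
    triangle : move (move (move v d₁) d₃) d₂ ≡ v
    triangle = begin
      move (move (move v d₁) d₃) d₂  ≡⟨ cong (λ x → move (move x d₃) d₂) u≡ ⟨
      move (move u d₃) d₂            ≡⟨ cong (λ x → move x d₂) w≡ ⟨
      move w d₂                      ≡⟨ v≡ ⟨
      v                              ∎

  nonisolated⇒vertical-neighbour : 4 ≤ r → Crit-iii L → Crit-iv L → ∀ v w → InComp L v w → w ≢ v →
    Σ Vertex λ x → Vert v x × InComp L v x
  nonisolated⇒vertical-neighbour 4≤r crit-iii crit-iv v w v⋯w w≢v with Path⇒≡⊎first-move v⋯w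
  ... | inj₁ w≡v = contradiction w≡v w≢v
  ... | inj₂ (u , v~u , Lu≈Lv) with same-list-neighbour⇒vertical 4≤r crit-iii crit-iv v~u Lu≈Lv
  ... | x , v∣x , Lx≈Lv = x , v∣x , step (here ≈L-refl) (inj₁ v∣x) Lx≈Lv

  module IsolatedVertex (1<r : 1 < r) (1<s : 1 < s) {v} (isolated : Isolated L v) where

    differs : ∀ d → ¬ (L (move v d) ≈L L v)
    differs d same = move-≢ 1<r 1<s v d
      (isolated (move v d) (step (here ≈L-refl) (move⇒Adj d refl) same))

    lists-left-and-below : Crit-ii L →
        (Lat L v -[1+ 0 ] (+ 0) ≈L Lat L v (+ 0) -[1+ 0 ])
      × (Lat L v -[1+ 0 ] -[1+ 0 ] ≈L Lat L v (+ 0) -[1+ 0 ])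
      × (Lat L v (+ 1) -[1+ 0 ] ≈L Lat L v (+ 0) -[1+ 0 ])
    lists-left-and-below crit-ii = case crit-ii v (λ same → differs down (≈L-sym same)) of λ where
      (inj₁ (same , _) , _)                        → contradiction (≈L-sym same) (differs left-up)
      (inj₂ (inj₁ (same , _)) , _)                 → contradiction (≈L-sym same) (differs left-up)
      (inj₂ (inj₂ _) , inj₁ (same , _))            → contradiction (≈L-sym same) (differs right)
      (inj₂ (inj₂ _) , inj₂ (inj₂ (_ , same , _))) → contradiction (≈L-sym same) (differs right-down)
      (inj₂ (inj₂ (_ , below≈left , left≈left-of-below)) ,
       inj₂ (inj₁ (below≈right-down-of-below , right-down-of-below≈right-down , _))) →
        ≈L-sym below≈left , ≈L-sym (≈L-trans below≈left left≈left-of-below) ,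
        ≈L-sym (≈L-trans below≈right-down-of-below right-down-of-below≈right-down)

    private
      above = at v (+ 0) (+ 1)

      from-above : ∀ a b → Lat L above a b ≈L Lat L v (+ 0 + a) (+ 1 + b)
      from-above a b = ≡⇒≈L (cong L (at-at v (+ 0) (+ 1) a b))

      below-above : Lat L above (+ 0) -[1+ 0 ] ≈L L v
      below-above = ≈L-trans (from-above (+ 0) -[1+ 0 ]) (≡⇒≈L (cong L (at-0-0 v)))

      ≈below-above⇒≈v : ∀ a b → Lat L above (+ 0) -[1+ 0 ] ≈L Lat L above a b →
        Lat L v (+ 0 + a) (+ 1 + b) ≈L L v
      ≈below-above⇒≈v a b same = ≈L-trans (≈L-sym (from-above a b)) (≈L-trans (≈L-sym same) below-above)

    lists-right-and-above : Crit-ii L →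
        (Lat L v -[1+ 0 ] (+ 1) ≈L Lat L v (+ 0) (+ 1))
      × (Lat L v (+ 1) (+ 1) ≈L Lat L v (+ 0) (+ 1))
      × (Lat L v (+ 1) (+ 0) ≈L Lat L v (+ 0) (+ 1))
    lists-right-and-above crit-ii = case crit-ii above (λ same → differs up (≈L-trans same below-above)) of λ where
      (inj₁ (_ , same) , _) →
        contradiction (≈below-above⇒≈v -[1+ 0 ] -[1+ 0 ] same) (differs left)
      (inj₂ (inj₂ (_ , same , _)) , _) →
        contradiction (≈below-above⇒≈v -[1+ 0 ] (+ 0) same) (differs left-up)
      (inj₂ (inj₁ _) , inj₁ (_ , same)) →
        contradiction (≈below-above⇒≈v (+ 1) -[1+ 1 ] same) (differs right-down)
      (inj₂ (inj₁ _) , inj₂ (inj₁ (same , _ , _))) →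
        contradiction (≈below-above⇒≈v (+ 1) -[1+ 1 ] same) (differs right-down)
      (inj₂ (inj₁ (above≈left-up-of-above , left-up-of-above≈left-up , _)) ,
       inj₂ (inj₂ (_ , above≈right , right≈right-of-above))) →
        ≈L-sym (≈L-trans above≈left-up-of-above (≈L-trans left-up-of-above≈left-up (from-above -[1+ 0 ] (+ 0)))) ,
        ≈L-sym (≈L-trans above≈right (≈L-trans right≈right-of-above (from-above (+ 1) (+ 0)))) ,
        ≈L-sym (≈L-trans above≈right (from-above (+ 1) -[1+ 0 ]))

    above≉below : Size5 L → Crit-i L →
      Lat L v -[1+ 0 ] (+ 0) ≈L Lat L v (+ 0) -[1+ 0 ] →
      Lat L v -[1+ 0 ] (+ 1) ≈L Lat L v (+ 0) (+ 1) →
      ¬ (Lat L v (+ 0) (+ 1) ≈L Lat L v (+ 0) -[1+ 0 ])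
    above≉below size5 (_ , covered-by-left , _) left≈below left-up≈above above≈below =
      differs down (≈L-sym (Size5-⊆⇒≈L size5 Lv⊆below))
      where
      Lv⊆below : L v ⊆ Lat L v (+ 0) -[1+ 0 ]
      Lv⊆below x∈Lv with covered-by-left v x∈Lv
      ... | inj₁ x∈left    = proj₁ left≈below x∈left
      ... | inj₂ x∈left-up = proj₁ (≈L-trans left-up≈above above≈below) x∈left-up

    isolated⇒neighbourhood : Size5 L → Crit-i L → Crit-ii L →
      Σ Colours λ L′ → Σ Colours λ L″ → ¬ (L′ ≈L L″)
        × (Lat L v -[1+ 0 ] (+ 1) ≈L L′) × (Lat L v (+ 0) (+ 1) ≈L L′)
        × (Lat L v (+ 1) (+ 1) ≈L L′) × (Lat L v (+ 1) (+ 0) ≈L L′)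
        × (Lat L v -[1+ 0 ] (+ 0) ≈L L″) × (Lat L v -[1+ 0 ] -[1+ 0 ] ≈L L″)
        × (Lat L v (+ 0) -[1+ 0 ] ≈L L″) × (Lat L v (+ 1) -[1+ 0 ] ≈L L″)
    isolated⇒neighbourhood size5 crit-i crit-ii =
      let left≈below , left-of-below≈below , right-down≈below = lists-left-and-below crit-ii
          left-up≈above , right-of-above≈above , right≈above   = lists-right-and-above crit-ii
      in Lat L v (+ 0) (+ 1) , Lat L v (+ 0) -[1+ 0 ] ,
         above≉below size5 crit-i left≈below left-up≈above ,
         left-up≈above , ≈L-refl , right-of-above≈above , right≈above ,
         left≈below , left-of-below≈below , ≈L-refl , right-down≈below

lemma15 : (r s t : ℕ) .{{_ : NonZero r}} .{{_ : NonZero s}} →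
    4 ≤ r → 3 ≤ s → t < s →
    let open Torus r s t in
    (L : ListAssignment) → Size5 L →
    Crit-i L → Crit-ii L → Crit-iii L → Crit-iv L →
    ((v : Vertex) → Isolated L v →
      Σ Colours λ L′ → Σ Colours λ L″ → ¬ (L′ ≈L L″)
        × (Lat L v -[1+ 0 ] (+ 1) ≈L L′) × (Lat L v (+ 0) (+ 1) ≈L L′)
        × (Lat L v (+ 1) (+ 1) ≈L L′) × (Lat L v (+ 1) (+ 0) ≈L L′)
        × (Lat L v -[1+ 0 ] (+ 0) ≈L L″) × (Lat L v -[1+ 0 ] -[1+ 0 ] ≈L L″)
        × (Lat L v (+ 0) -[1+ 0 ] ≈L L″) × (Lat L v (+ 1) -[1+ 0 ] ≈L L″))
    × ((v w : Vertex) → InComp L v w → ¬ (w ≡ v) →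
      Σ Vertex λ x → Vert v x × InComp L v x)
lemma15 r s t 4≤r 3≤s _ L size5 crit-i crit-ii crit-iii crit-iv =
  (λ v isolated → IsolatedVertex.isolated⇒neighbourhood 1<r 1<s isolated size5 crit-i crit-ii) ,
  nonisolated⇒vertical-neighbour 4≤r crit-iii crit-iv
  where
  open ListClasses r s t L
  1<r : 1 < r
  1<r = ℕP.≤-trans (s≤s (s≤s z≤n)) 4≤r
  1<s : 1 < s
  1<s = ℕP.≤-trans (s≤s (s≤s z≤n)) 3≤s
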